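{- Let $p \geq 1$ be an integer. Then for every integer $n \geq 1$, \[ F_n - n^{p} \;=\; \sum_{i=1}^{n} \left( i^{p} - 2\sum_{j=0}^{\lfloor p/2\rfloor} \binom{p}{2j+1} i^{p-2j-1} \right) F_{n-i}. \]
   Context: $F_n$ denotes the Fibonacci numbers: $F_0=0$, $F_1=1$, $F_n=F_{n-1}+F_{n-2}$ for $n>1$. Binomial coefficients $\binom{p}{m}$ with $m>p$ are $0$ (so terms with $2j+1>p$ vanish), and $i^0=1$. -}

module Defs where

open import Data.Nat using (ℕ; zero; suc; _∸_; _/_)
open import Data.Nat.Combinatorics using (_C_)
open import Data.Integer using (ℤ; +_; _+_; _-_; _*_; _^_)

F : ℕ → ℕ
F zero = 0
F (suc zero) = 1
F (suc (suc n)) = F (suc n) Data.Nat.+ F n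

sumFrom : ℕ → ℕ → (ℕ → ℤ) → ℤ
sumFrom a zero f = + 0
sumFrom a (suc m) f = f a + sumFrom (suc a) m f

-- Σ_{i=lo}^{hi} f i  (empty when hi < lo)
sumRange : ℕ → ℕ → (ℕ → ℤ) → ℤ
sumRange lo hi f = sumFrom lo (suc hi ∸ lo) f

-- inner summand: Σ_{j=0}^{⌊p/2⌋} C(p, 2j+1) i^(p-2j-1)
-- (C(p,m) = 0 for m > p, so ∸ truncation there is harmless)
inner : ℕ → ℕ → ℤ
inner p i = sumRange 0 (p / 2) (λ j → + (p C (suc (2 Data.Nat.* j))) * ((+ i) ^ (p ∸ suc (2 Data.Nat.* j))))

{-# OPTIONS --safe #-}
-- The summand of the sum is i ^ p − ((i + 1) ^ p − (i − 1) ^ p), because twice the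
-- odd-index half of the binomial expansion of (i + 1) ^ p is (i + 1) ^ p − (i − 1) ^ p.
-- Hence both sides, as sequences in n, satisfy u (n + 2) = u (n + 1) + u n + b n with the
-- same forcing term b n = (n + 1) ^ p − (n + 2) ^ p + n ^ p: for the convolution of b with
-- the Fibonacci numbers this is Fibonacci's recurrence, for F n − n ^ p it is immediate.
-- Both sequences start with 0, 0 (F 0 − 0 ^ p = 0 is where p ≥ 1 is needed), so they coincide.
module Submission where

open import Defs
open import Data.Nat using (ℕ; zero; suc; _≥_; _≤_; _<_; _∸_; _/_; z≤n; s≤s; _<?_)
import Data.Nat as ℕ
import Data.Integer.Properties as ℤ
open import Data.Nat.Properties
  using (+-comm; +-∸-assoc; ≮⇒≥; *-comm; *-suc; +-monoˡ-≤; ≤-pred; n≤1+n; ≤-trans; +-suc; +-identityʳ)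
open import Data.Nat.DivMod using (m≡m%n+[m/n]*n; m%n<n)
open import Data.Nat.Combinatorics using (_C_; nCk+nC[k+1]≡[n+1]C[k+1]; k>n⇒nCk≡0)
open import Data.Integer using (ℤ; +_; _+_; _-_; _*_; _^_)
open import Data.Integer.Tactic.RingSolver using (solve-∀)
open import Data.Product using (_×_; _,_; proj₁; proj₂)
open import Function using (_∘_)
open import Relation.Binary.PropositionalEquality
open import Relation.Nullary using (yes; no)

open ≡-Reasoning

sumFrom-suc : ∀ a m (f : ℕ → ℤ) → sumFrom (suc a) m f ≡ sumFrom a m (f ∘ suc)
sumFrom-suc a zero    f = refl
sumFrom-suc a (suc m) f = cong (_+_ (f (suc a))) (sumFrom-suc (suc a) m f)

sumFrom-cong : ∀ a m {f g : ℕ → ℤ} → (∀ k → f k ≡ g k) → sumFrom a m f ≡ sumFrom a m g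
sumFrom-cong a zero    f≗g = refl
sumFrom-cong a (suc m) f≗g = cong₂ _+_ (f≗g a) (sumFrom-cong (suc a) m f≗g)

sumFrom-zero : ∀ a m {f : ℕ → ℤ} → (∀ k → f k ≡ + 0) → sumFrom a m f ≡ + 0
sumFrom-zero a zero    f≗0 = refl
sumFrom-zero a (suc m) f≗0 = cong₂ _+_ (f≗0 a) (sumFrom-zero (suc a) m f≗0)

sumFrom-+ : ∀ a m (f g : ℕ → ℤ) →
  sumFrom a m (λ k → f k + g k) ≡ sumFrom a m f + sumFrom a m g
sumFrom-+ a zero    f g = refl
sumFrom-+ a (suc m) f g = begin
  (f a + g a) + sumFrom (suc a) m (λ k → f k + g k)
    ≡⟨ cong (_+_ (f a + g a)) (sumFrom-+ (suc a) m f g) ⟩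
  (f a + g a) + (sumFrom (suc a) m f + sumFrom (suc a) m g)
    ≡⟨ interchange (f a) (g a) _ _ ⟩
  (f a + sumFrom (suc a) m f) + (g a + sumFrom (suc a) m g) ∎
  where
  interchange : ∀ w x y z → (w + x) + (y + z) ≡ (w + y) + (x + z)
  interchange = solve-∀

sumFrom-*ˡ : ∀ a m c (f : ℕ → ℤ) → sumFrom a m (λ k → c * f k) ≡ c * sumFrom a m f
sumFrom-*ˡ a zero    c f = sym (ℤ.*-zeroʳ c)
sumFrom-*ˡ a (suc m) c f =
  trans (cong (_+_ (c * f a)) (sumFrom-*ˡ (suc a) m c f)) (sym (ℤ.*-distribˡ-+ c _ _))

sumFrom-snoc : ∀ a m (f : ℕ → ℤ) → sumFrom a (suc m) f ≡ sumFrom a m f + f (a ℕ.+ m)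
sumFrom-snoc a zero    f rewrite +-identityʳ a = ℤ.+-comm (f a) (+ 0)
sumFrom-snoc a (suc m) f rewrite +-suc a m =
  trans (cong (_+_ (f a)) (sumFrom-snoc (suc a) m f)) (sym (ℤ.+-assoc (f a) _ _))

binomTerm : ℕ → ℕ → ℤ → ℤ
binomTerm p k x = + (p C k) * x ^ (p ∸ k)

binomTerm-vanish : ∀ {p k} x → p < k → binomTerm p k x ≡ + 0
binomTerm-vanish {p} {k} x p<k rewrite k>n⇒nCk≡0 p<k = ℤ.*-zeroˡ (x ^ (p ∸ k))

binomTerm-zero : ∀ p x → binomTerm (suc p) 0 x ≡ x * binomTerm p 0 x
binomTerm-zero p x = trans (ℤ.*-identityˡ (x ^ suc p)) (cong (x *_) (sym (ℤ.*-identityˡ (x ^ p))))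

-- The coefficient vanishes exactly when the exponent p ∸ k would be truncated.
binomTerm-lower : ∀ p k x → + (p C suc k) * x ^ (p ∸ k) ≡ x * binomTerm p (suc k) x
binomTerm-lower p k x with k <? p
... | yes k<p rewrite +-∸-assoc 1 k<p = *-left-comm (+ (p C suc k)) x (x ^ (p ∸ suc k))
  where
  *-left-comm : ∀ a b c → a * (b * c) ≡ b * (a * c)
  *-left-comm = solve-∀
... | no  k≮p rewrite k>n⇒nCk≡0 {p} {suc k} (s≤s (≮⇒≥ k≮p)) =
  trans (ℤ.*-zeroˡ (x ^ (p ∸ k))) (sym (trans (cong (x *_) (ℤ.*-zeroˡ (x ^ (p ∸ suc k)))) (ℤ.*-zeroʳ x)))

binomTerm-suc : ∀ p k x →
  binomTerm (suc p) (suc k) x ≡ x * binomTerm p (suc k) x + binomTerm p k x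
binomTerm-suc p k x = begin
  + (suc p C suc k) * x ^ (p ∸ k)
    ≡⟨ cong (λ c → + c * x ^ (p ∸ k)) (sym (nCk+nC[k+1]≡[n+1]C[k+1] p k)) ⟩
  (+ (p C k) + + (p C suc k)) * x ^ (p ∸ k)
    ≡⟨ distrib-swap (+ (p C k)) (+ (p C suc k)) (x ^ (p ∸ k)) ⟩
  + (p C suc k) * x ^ (p ∸ k) + binomTerm p k x
    ≡⟨ cong (_+ binomTerm p k x) (binomTerm-lower p k x) ⟩
  x * binomTerm p (suc k) x + binomTerm p k x ∎
  where
  distrib-swap : ∀ a b c → (a + b) * c ≡ b * c + a * c
  distrib-swap = solve-∀

evenPart oddPart : ℕ → ℕ → ℤ → ℤ
evenPart M p x = sumFrom 0 M (λ j → binomTerm p (2 ℕ.* j) x)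
oddPart  M p x = sumFrom 0 M (λ j → binomTerm p (suc (2 ℕ.* j)) x)

oddPart-suc : ∀ M p x → oddPart M (suc p) x ≡ x * oddPart M p x + evenPart M p x
oddPart-suc M p x = begin
  oddPart M (suc p) x
    ≡⟨ sumFrom-cong 0 M (λ j → binomTerm-suc p (2 ℕ.* j) x) ⟩
  sumFrom 0 M (λ j → x * binomTerm p (suc (2 ℕ.* j)) x + binomTerm p (2 ℕ.* j) x)
    ≡⟨ sumFrom-+ 0 M _ _ ⟩
  sumFrom 0 M (λ j → x * binomTerm p (suc (2 ℕ.* j)) x) + evenPart M p x
    ≡⟨ cong (_+ evenPart M p x) (sumFrom-*ˡ 0 M x _) ⟩
  x * oddPart M p x + evenPart M p x ∎

evenPart-suc : ∀ M p x → evenPart (suc M) (suc p) x ≡ x * evenPart (suc M) p x + oddPart M p x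
evenPart-suc M p x = begin
  binomTerm (suc p) 0 x + sumFrom 1 M (λ j → binomTerm (suc p) (2 ℕ.* j) x)
    ≡⟨ cong₂ _+_ (binomTerm-zero p x) (sumFrom-suc 0 M _) ⟩
  x * binomTerm p 0 x + sumFrom 0 M (λ j → binomTerm (suc p) (2 ℕ.* suc j) x)
    ≡⟨ cong (_+_ (x * binomTerm p 0 x)) (sumFrom-cong 0 M shiftedTerm) ⟩
  x * binomTerm p 0 x + sumFrom 0 M (λ j → x * binomTerm p (2 ℕ.* suc j) x + binomTerm p (suc (2 ℕ.* j)) x)
    ≡⟨ cong (_+_ (x * binomTerm p 0 x)) (sumFrom-+ 0 M _ _) ⟩
  x * binomTerm p 0 x + (sumFrom 0 M (λ j → x * binomTerm p (2 ℕ.* suc j) x) + oddPart M p x)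
    ≡⟨ cong (λ s → x * binomTerm p 0 x + (s + oddPart M p x)) (sumFrom-*ˡ 0 M x _) ⟩
  x * binomTerm p 0 x + (x * evenTail + oddPart M p x)
    ≡⟨ factor x (binomTerm p 0 x) evenTail (oddPart M p x) ⟩
  x * (binomTerm p 0 x + evenTail) + oddPart M p x
    ≡⟨ cong (λ s → x * (binomTerm p 0 x + s) + oddPart M p x) (sym (sumFrom-suc 0 M _)) ⟩
  x * evenPart (suc M) p x + oddPart M p x ∎
  where
  factor : ∀ x a b c → x * a + (x * b + c) ≡ x * (a + b) + c
  factor = solve-∀
  evenTail : ℤ
  evenTail = sumFrom 0 M (λ j → binomTerm p (2 ℕ.* suc j) x)
  shiftedTerm : ∀ j → binomTerm (suc p) (2 ℕ.* suc j) x
                    ≡ x * binomTerm p (2 ℕ.* suc j) x + binomTerm p (suc (2 ℕ.* j)) x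
  shiftedTerm j = subst (λ k → binomTerm (suc p) k x ≡ x * binomTerm p k x + binomTerm p (suc (2 ℕ.* j)) x)
                        (sym (*-suc 2 j)) (binomTerm-suc p (suc (2 ℕ.* j)) x)

oddPart-extend : ∀ M {p} x → p ≤ 2 ℕ.* M → oddPart (suc M) p x ≡ oddPart M p x
oddPart-extend M {p} x p≤2M = begin
  oddPart (suc M) p x
    ≡⟨ sumFrom-snoc 0 M _ ⟩
  oddPart M p x + binomTerm p (suc (2 ℕ.* M)) x
    ≡⟨ cong (_+_ (oddPart M p x)) (binomTerm-vanish x (s≤s p≤2M)) ⟩
  oddPart M p x + + 0
    ≡⟨ ℤ.+-identityʳ (oddPart M p x) ⟩
  oddPart M p x ∎

evenPart-zero : ∀ M x → evenPart (suc M) 0 x ≡ + 1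
evenPart-zero M x = cong (_+_ (+ 1))
  (trans (sumFrom-suc 0 M _) (sumFrom-zero 0 M (λ j → binomTerm-vanish {k = 2 ℕ.* suc j} x (s≤s z≤n))))

oddPart-zero : ∀ M x → oddPart M 0 x ≡ + 0
oddPart-zero M x = sumFrom-zero 0 M (λ j → binomTerm-vanish {k = suc (2 ℕ.* j)} x (s≤s z≤n))

binomial-split : ∀ M {p} x → p ≤ suc (2 ℕ.* M) →
  (x + + 1) ^ p ≡ evenPart (suc M) p x + oddPart (suc M) p x ×
  (x - + 1) ^ p ≡ evenPart (suc M) p x - oddPart (suc M) p x
binomial-split M {zero} x _ rewrite evenPart-zero M x | oddPart-zero (suc M) x = refl , refl
binomial-split M {suc p} x 1+p≤1+2M = split₊ , split₋
  where
  p≤2M : p ≤ 2 ℕ.* M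
  p≤2M = ≤-pred 1+p≤1+2M
  E O : ℤ
  E = evenPart (suc M) p x
  O = oddPart (suc M) p x
  ih : (x + + 1) ^ p ≡ E + O × (x - + 1) ^ p ≡ E - O
  ih = binomial-split M {p} x (≤-trans p≤2M (n≤1+n _))
  evenPart-step : evenPart (suc M) (suc p) x ≡ x * E + O
  evenPart-step = trans (evenPart-suc M p x) (cong (_+_ (x * E)) (sym (oddPart-extend M x p≤2M)))
  oddPart-step : oddPart (suc M) (suc p) x ≡ x * O + E
  oddPart-step = oddPart-suc (suc M) p x
  expand₊ : ∀ x e o → (x + + 1) * (e + o) ≡ (x * e + o) + (x * o + e)
  expand₊ = solve-∀
  expand₋ : ∀ x e o → (x - + 1) * (e - o) ≡ (x * e + o) - (x * o + e)
  expand₋ = solve-∀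
  split₊ : (x + + 1) ^ suc p ≡ evenPart (suc M) (suc p) x + oddPart (suc M) (suc p) x
  split₊ = begin
    (x + + 1) * (x + + 1) ^ p  ≡⟨ cong ((x + + 1) *_) (proj₁ ih) ⟩
    (x + + 1) * (E + O)        ≡⟨ expand₊ x E O ⟩
    (x * E + O) + (x * O + E)  ≡⟨ sym (cong₂ _+_ evenPart-step oddPart-step) ⟩
    evenPart (suc M) (suc p) x + oddPart (suc M) (suc p) x ∎
  split₋ : (x - + 1) ^ suc p ≡ evenPart (suc M) (suc p) x - oddPart (suc M) (suc p) x
  split₋ = begin
    (x - + 1) * (x - + 1) ^ p  ≡⟨ cong ((x - + 1) *_) (proj₂ ih) ⟩
    (x - + 1) * (E - O)        ≡⟨ expand₋ x E O ⟩
    (x * E + O) - (x * O + E)  ≡⟨ sym (cong₂ _-_ evenPart-step oddPart-step) ⟩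
    evenPart (suc M) (suc p) x - oddPart (suc M) (suc p) x ∎

n≤1+2*[n/2] : ∀ n → n ≤ suc (2 ℕ.* (n / 2))
n≤1+2*[n/2] n = subst (n ≤_) (cong suc (*-comm (n / 2) 2))
  (subst (_≤ suc (n / 2 ℕ.* 2)) (sym (m≡m%n+[m/n]*n n 2))
    (+-monoˡ-≤ (n / 2 ℕ.* 2) (≤-pred (m%n<n n 2))))

-- inner p i is oddPart (1 + ⌊p/2⌋) p i, the odd-index half of the expansion of (i + 1) ^ p.
inner-difference : ∀ p m → + 2 * inner p (suc m) ≡ (+ suc (suc m)) ^ p - (+ m) ^ p
inner-difference p m = begin
  + 2 * O                ≡⟨ twice-odd E O ⟩
  (E + O) - (E - O)      ≡⟨ sym (cong₂ _-_ (proj₁ split) (proj₂ split)) ⟩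
  (+ suc m + + 1) ^ p - (+ m) ^ p
                         ≡⟨ cong (λ k → (+ k) ^ p - (+ m) ^ p) (+-comm (suc m) 1) ⟩
  (+ suc (suc m)) ^ p - (+ m) ^ p ∎
  where
  E O : ℤ
  E = evenPart (suc (p / 2)) p (+ suc m)
  O = oddPart (suc (p / 2)) p (+ suc m)
  split : (+ suc m + + 1) ^ p ≡ E + O × (+ suc m - + 1) ^ p ≡ E - O
  split = binomial-split (p / 2) (+ suc m) (n≤1+2*[n/2] p)
  twice-odd : ∀ e o → + 2 * o ≡ (e + o) - (e - o)
  twice-odd = solve-∀

fibConv : (ℕ → ℤ) → ℕ → ℤ
fibConv b m = sumFrom 0 m (λ k → b k * + F (m ∸ suc k))

fibConv-suc : ∀ b m → fibConv b (suc m) ≡ b 0 * + F m + fibConv (b ∘ suc) m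
fibConv-suc b m = cong (_+_ (b 0 * + F m)) (sumFrom-suc 0 m _)

FibRecurrence : (ℕ → ℤ) → (ℕ → ℤ) → Set
FibRecurrence b u = ∀ m → u (suc (suc m)) ≡ u (suc m) + u m + b m

fibConv-recurrence : ∀ b → FibRecurrence b (fibConv b)
fibConv-recurrence b zero = base (b 0) (b 1)
  where
  base : ∀ b₀ b₁ → b₀ * + 1 + (b₁ * + 0 + + 0) ≡ (b₀ * + 0 + + 0) + + 0 + b₀
  base = solve-∀
fibConv-recurrence b (suc m) = begin
  fibConv b (suc (suc (suc m)))
    ≡⟨ fibConv-suc b (suc (suc m)) ⟩
  b 0 * (+ F (suc m) + + F m) + fibConv (b ∘ suc) (suc (suc m))
    ≡⟨ cong (_+_ (b 0 * (+ F (suc m) + + F m))) (fibConv-recurrence (b ∘ suc) m) ⟩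
  b 0 * (+ F (suc m) + + F m) + (fibConv (b ∘ suc) (suc m) + fibConv (b ∘ suc) m + b (suc m))
    ≡⟨ regroup (b 0) (+ F (suc m)) (+ F m) _ _ (b (suc m)) ⟩
  (b 0 * + F (suc m) + fibConv (b ∘ suc) (suc m)) + (b 0 * + F m + fibConv (b ∘ suc) m) + b (suc m)
    ≡⟨ sym (cong₂ (λ s t → s + t + b (suc m)) (fibConv-suc b (suc m)) (fibConv-suc b m)) ⟩
  fibConv b (suc (suc m)) + fibConv b (suc m) + b (suc m) ∎
  where
  regroup : ∀ a f₁ f₀ c₁ c₀ d → a * (f₁ + f₀) + (c₁ + c₀ + d) ≡ (a * f₁ + c₁) + (a * f₀ + c₀) + d
  regroup = solve-∀

FibRecurrence-unique : ∀ {b u v} → FibRecurrence b u → FibRecurrence b v →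
  u 0 ≡ v 0 → u 1 ≡ v 1 → ∀ m → u m ≡ v m
FibRecurrence-unique {b} {u} {v} rec-u rec-v u₀≡v₀ u₁≡v₁ m = proj₁ (agree m)
  where
  agree : ∀ m → u m ≡ v m × u (suc m) ≡ v (suc m)
  agree zero    = u₀≡v₀ , u₁≡v₁
  agree (suc m) with agree m
  ... | uₘ≡vₘ , uₘ₊₁≡vₘ₊₁ = uₘ₊₁≡vₘ₊₁ ,
    trans (rec-u m) (trans (cong₂ (λ s t → s + t + b m) uₘ₊₁≡vₘ₊₁ uₘ≡vₘ) (sym (rec-v m)))

forcing : ℕ → ℕ → ℤ
forcing p k = (+ suc k) ^ p - + 2 * inner p (suc k)

fib-power-recurrence : ∀ p → FibRecurrence (forcing p) (λ n → + F n - (+ n) ^ p)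
fib-power-recurrence p m = begin
  + F (suc (suc m)) - P₂
    ≡⟨ telescope (+ F (suc m)) (+ F m) P₀ P₁ P₂ ⟩
  (+ F (suc m) - P₁) + (+ F m - P₀) + (P₁ - (P₂ - P₀))
    ≡⟨ cong (λ d → (+ F (suc m) - P₁) + (+ F m - P₀) + (P₁ - d)) (sym (inner-difference p m)) ⟩
  (+ F (suc m) - P₁) + (+ F m - P₀) + forcing p m ∎
  where
  P₀ P₁ P₂ : ℤ
  P₀ = (+ m) ^ p
  P₁ = (+ suc m) ^ p
  P₂ = (+ suc (suc m)) ^ p
  telescope : ∀ f₁ f₀ p₀ p₁ p₂ → (f₁ + f₀) - p₂ ≡ (f₁ - p₁) + (f₀ - p₀) + (p₁ - (p₂ - p₀))
  telescope = solve-∀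

theorem1 : (p : ℕ) → p ≥ 1 → (n : ℕ) → n ≥ 1 →
    (+ F n) - (+ n) ^ p
      ≡ sumRange 1 n (λ i → ((+ i) ^ p - (+ 2) * inner p i) * (+ F (n ∸ i)))
theorem1 (suc q) _ n _ = sym (trans (sumFrom-suc 0 n _)
  (FibRecurrence-unique {u = fibConv (forcing p)} {v = λ n → + F n - (+ n) ^ p}
    (fibConv-recurrence (forcing p)) (fib-power-recurrence p) initial₀ initial₁ n))
  where
  p : ℕ
  p = suc q
  initial₀ : fibConv (forcing p) 0 ≡ + 0 - (+ 0) ^ p
  initial₀ = sym (cong (λ z → + 0 - z) (ℤ.*-zeroˡ ((+ 0) ^ q)))
  initial₁ : fibConv (forcing p) 1 ≡ + 1 - (+ 1) ^ p
  initial₁ = trans (cong (λ z → z + + 0) (ℤ.*-zeroʳ (forcing p 0)))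
                   (sym (cong (λ z → + 1 - z) (ℤ.^-zeroˡ p)))
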